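{- Let $X$ be a tree all of whose vertices have valency $q+1$, $G=\mathrm{Aut}(X)$, and $P,N,w$ as in the context. Then $G$ is the disjoint union $G=P\cup PwP$, and $PwP=NwP=PwN$.
   Context: $G$ has the topology in which pointwise stabilizers of finite nonempty vertex sets form a neighbourhood basis of $1$. Fix a line $(\dots,v_{ -1},v_0,v_1,\dots)$ in $X$ (two-sided path without backtracking); let $\infty$ be the cusp (parallelity class of rays) of $(v_0,v_1,\dots)$ and $0$ that of $(v_0,v_{ -1},\dots)$; $P$ is the stabilizer of $\infty$, $S\subset P$ the subgroup preserving every horosphere (vertices lie in the same horosphere if their rays towards $\infty$ eventually coincide with equal indices), $L$ the stabilizer of the line, $M=L\cap S$, $A$ the image of a splitting of $L\to L/M\cong\mathbb Z$. Fix a finite ring $R$ with $q$ elements and label, at each vertex, the $q$ edges not pointing towards $\infty$ bijectively by elements of $R$, so that at each $v_j$ the edge $\{v_j,v_{j-1}\}$ has label $0$ and the labelling is $A$-invariant. For a cusp $b\ne\infty$ with line $(\dots,w_{ -1},w_0,w_1,\dots)$ from $b$ to $\infty$ put $\psi(b)=\sum_j\mathrm{lab}(\{w_j,w_{j-1}\})t^j$, a formal Laurent series over $R$; $\psi$ is a bijection of $\partial X\setminus\{\infty\}$ onto these series. $N$ is the subgroup of $n\in S$ for which there is a series $n_R$ with $\psi(nb)=\psi(b)+n_R$ for all cusps $b\ne\infty$. $w\in G$ is an element with $w^2=1$, $wv_j=v_{ -j}$ for all $j$, and $waw=a^{ -1}$ for all $a\in A$. -}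

module Defs where

open import Level using (0ℓ)
open import Data.Nat as ℕ using (ℕ; zero; suc; _≤_)
open import Data.Integer as ℤ using (ℤ; +_; -_; _-_; 1ℤ)
open import Data.Bool using (Bool; T)
open import Data.Fin using (Fin)
open import Data.Product using (Σ; ∃; ∃₂; _×_; _,_)
open import Relation.Nullary using (¬_; Dec)
open import Relation.Binary.PropositionalEquality using (_≡_; _≢_; setoid)
open import Algebra.Bundles using (Ring)
open import Function.Bundles using (Inverse; _↔_)

-- Excluded middle (the paper's ambient mathematics is classical).

ExcludedMiddle : Set₁
ExcludedMiddle = (A : Set) → Dec A

-- Regular trees of valency q+1.
-- A graph on a vertex type V with (Boolean, hence proof-irrelevant)
-- symmetric adjacency.

record Tree (q : ℕ) : Set₁ where
  field
    V   : Set
    adj : V → V → Bool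
  _~_ : V → V → Set
  u ~ x = T (adj u x)

  IsReducedWalk : V → V → ℕ → (ℕ → V) → Set
  IsReducedWalk u x n f =
    f 0 ≡ u × f n ≡ x
    × (∀ i → suc i ≤ n → f i ~ f (suc i))
    × (∀ i → suc (suc i) ≤ n → f i ≢ f (suc (suc i)))

  field
    adj-sym     : ∀ u x → adj u x ≡ adj x u
    walk-exists : ∀ u x → ∃₂ λ n f → IsReducedWalk u x n f
    walk-unique : ∀ u x n m f g → IsReducedWalk u x n f → IsReducedWalk u x m g
                  → n ≡ m × (∀ i → i ≤ n → f i ≡ g i)
    valency     : ∀ u → Σ V (u ~_) ↔ Fin (suc q)

-- Automorphisms of a tree: adjacency-preserving bijections.  Two
-- automorphisms are equal iff they agree on every vertex.

module _ {q : ℕ} (X : Tree q) where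
  open Tree X

  record Aut : Set where
    field
      fun     : V → V
      inv     : V → V
      inv-fun : ∀ x → inv (fun x) ≡ x
      fun-inv : ∀ x → fun (inv x) ≡ x
      pres    : ∀ x y → adj (fun x) (fun y) ≡ adj x y

module TreeNotions {q : ℕ} (X : Tree q) where
  open Tree X public
  open Aut public

  IsRay : (ℕ → V) → Set
  IsRay r = (∀ i → r i ~ r (suc i)) × (∀ i → r i ≢ r (suc (suc i)))

  IsLine : (ℤ → V) → Set
  IsLine l = (∀ j → l j ~ l (ℤ.suc j)) × (∀ j → l j ≢ l (ℤ.suc (ℤ.suc j)))

  -- parallelity of rays (they eventually coincide up to an index shift);
  -- cusps = parallelity classes of rays
  _∥_ : (ℕ → V) → (ℕ → V) → Set
  r ∥ r' = ∃₂ λ k m → ∀ i → r (k ℕ.+ i) ≡ r' (m ℕ.+ i)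

  fwd : (ℤ → V) → ℕ → V
  fwd l i = l (+ i)

  bwd : (ℤ → V) → ℕ → V
  bwd l i = l (- (+ i))

  module Relative (v : ℤ → V) where
    -- the cusp ∞ is the class of fwd v
    ray∞ : ℕ → V
    ray∞ = fwd v

    RayTo∞ : V → (ℕ → V) → Set
    RayTo∞ u r = IsRay r × r 0 ≡ u × r ∥ ray∞

    SameHoro : V → V → Set
    SameHoro u u' = ∃₂ λ r r' → RayTo∞ u r × RayTo∞ u' r'
                    × ∃ λ k → ∀ i → r (k ℕ.+ i) ≡ r' (k ℕ.+ i)

    Up : V → V → Set
    Up u u' = ∃ λ r → RayTo∞ u r × r 1 ≡ u'

    Down : V → V → Set
    Down u u' = u ~ u' × ¬ Up u u'

    InP : Aut X → Set
    InP g = (λ i → fun g (ray∞ i)) ∥ ray∞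

    InS : Aut X → Set
    InS g = InP g × (∀ u → SameHoro u (fun g u))

    LineFrom : (ℕ → V) → (ℤ → V) → Set
    LineFrom b w = IsLine w × bwd w ∥ b × fwd w ∥ ray∞
                   × (∀ j → SameHoro (w j) (v j))

record Setup (q : ℕ) : Set₁ where
  field
    X : Tree q
  open TreeNotions X
  field
    v      : ℤ → V
    v-line : IsLine v
  open Relative v public
  field
    -- A = image of a splitting σ : ℤ → L of L → L/M ≅ ℤ, where
    -- L = stabilizer of the (oriented) line v, M = L ∩ S;
    -- σ n translates the line by n.
    σ       : ℤ → Aut X
    σ-hom   : ∀ m n x → fun (σ (m ℤ.+ n)) x ≡ fun (σ m) (fun (σ n) x)
    σ-shift : ∀ n j → fun (σ n) (v j) ≡ v (j ℤ.+ n)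
    R      : Ring 0ℓ 0ℓ
    R-size : Inverse (Ring.setoid R) (setoid (Fin q))
  open Ring R using (Carrier; _≈_; 0#) renaming (_+_ to _+ᴿ_)
  field
    -- lab u u' is the label of the edge {u,u'} at u (for Down u u')
    lab        : V → V → Carrier
    lab-inj    : ∀ u x y → Down u x → Down u y → lab u x ≈ lab u y → x ≡ y
    lab-surj   : ∀ u c → ∃ λ x → Down u x × lab u x ≈ c
    lab-line   : ∀ j → lab (v j) (v (j - 1ℤ)) ≈ 0#
    lab-A-inv  : ∀ n x y → Down x y → lab (fun (σ n) x) (fun (σ n) y) ≈ lab x y
    w        : Aut X
    w-invol  : ∀ x → fun w (fun w x) ≡ x
    w-line   : ∀ j → fun w (v j) ≡ v (- j)
    w-A      : ∀ n x → fun w (fun (σ n) (fun w x)) ≡ fun (σ (- n)) x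

  -- coefficient of t^j in ψ(b), for the line w' from b to ∞
  coef : (ℤ → V) → ℤ → Carrier
  coef l j = lab (l j) (l (j - 1ℤ))

  InN : Aut X → Set
  InN g = InS g × ∃ λ (nR : ℤ → Carrier) →
            ∀ b → IsRay b → ¬ (b ∥ ray∞) → ∀ l l' →
            LineFrom b l → LineFrom (λ i → fun g (b i)) l' →
            ∀ j → coef l' j ≈ (coef l j +ᴿ nR j)

  In-w- : (Aut X → Set) → (Aut X → Set) → Aut X → Set
  In-w- H K g = ∃₂ λ h k → H h × K k × (∀ x → fun g x ≡ fun h (fun w (fun k x)))

  InPwP InNwP InPwN : Aut X → Set
  InPwP = In-w- InP InP
  InNwP = In-w- InN InP
  InPwN = In-w- InP InN

module Submission where

-- Orient the tree towards the cusp ∞: every vertex u has a parent (the next vertex on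
-- its ray to ∞) and a level (the Busemann function of ∞, normalised so that v j has
-- level j).  The labels of the edges on the way from u to ∞ form a sequence of
-- coordinates which, together with the level, determines u, and every level with
-- eventually vanishing coordinates occurs.  Adding to the coordinates an eventually
-- vanishing function of the level is therefore an automorphism fixing ∞, preserving
-- horospheres and translating ψ, i.e. an element of N.
--
-- If g does not fix ∞, the ray g(v₀, v₁, …) eventually descends, so it determines a line
-- from the cusp g∞ to ∞, and such a translation n maps the line v onto it.  Then
-- k = w n⁻¹ g fixes ∞ (as w maps 0 to ∞) and g = n w k.  Since w does not fix ∞, P and
-- PwP are disjoint, and applying the factorisation to g⁻¹ gives PwP = PwN.

open import Defs
open import Level using (0ℓ)
open import Data.Nat as ℕ using (ℕ; zero; suc; z≤n; s≤s)
import Data.Nat.Properties as ℕP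
open import Data.Integer as ℤ using (ℤ; +_; -[1+_]; -_; _-_; 1ℤ)
import Data.Integer.Properties as ℤP
open import Data.Integer.Tactic.RingSolver using (solve-∀)
open import Data.Bool using (true; false; T)
open import Data.Unit using (tt)
open import Data.Empty using (⊥; ⊥-elim)
open import Data.Product using (Σ; ∃; ∃₂; _×_; _,_; proj₁; proj₂)
open import Data.Sum using (_⊎_; inj₁; inj₂)
open import Relation.Nullary using (¬_; yes; no)
open import Relation.Binary.PropositionalEquality
open import Relation.Binary.Bundles using (Setoid)
open import Relation.Binary.Structures using (IsEquivalence)
import Relation.Binary.Reasoning.Setoid as SetoidReasoning
import Algebra.Properties.Ring as RingProperties
open import Algebra.Bundles using (Ring; AbelianGroup)
open import Algebra.Properties.CommutativeSemigroup ℕP.+-commutativeSemigroup using (x∙yz≈y∙xz)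
open import Algebra.Properties.Group (AbelianGroup.group ℤP.+-0-abelianGroup) using (∙-cancelʳ)

ℤ-upward-induction : ∀ (P : ℤ → Set) k → (∀ i → P (- + (k ℕ.+ i))) → (∀ j → P j → P (ℤ.suc j)) → ∀ j → P j
ℤ-upward-induction P k far step = λ where
    (+ n)    → subst P (cancel (+ (k ℕ.+ 0)) (+ n)) (climb _ (k ℕ.+ 0 ℕ.+ n) (far 0))
    -[1+ n ] → subst P (cancel′ (+ k) (+ suc n)) (climb _ k (far (suc n)))
  where
    one-more : ∀ a b → 1ℤ ℤ.+ (a ℤ.+ b) ≡ a ℤ.+ (1ℤ ℤ.+ b)
    one-more = solve-∀
    cancel : ∀ a b → - a ℤ.+ (a ℤ.+ b) ≡ b
    cancel = solve-∀
    cancel′ : ∀ a b → - (a ℤ.+ b) ℤ.+ a ≡ - b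
    cancel′ = solve-∀
    climb : ∀ a t → P a → P (a ℤ.+ + t)
    climb a zero    pₐ = subst P (sym (ℤP.+-identityʳ a)) pₐ
    climb a (suc t) pₐ = subst P (one-more a (+ t)) (step _ (climb a t pₐ))

T-⇔⇒≡ : ∀ {a b} → (T a → T b) → (T b → T a) → a ≡ b
T-⇔⇒≡ {false} {false} _ _ = refl
T-⇔⇒≡ {false} {true}  _ b⇒a = ⊥-elim (b⇒a tt)
T-⇔⇒≡ {true}  {false} a⇒b _ = ⊥-elim (a⇒b tt)
T-⇔⇒≡ {true}  {true}  _ _ = refl

module TreeFacts {q : ℕ} (X : Tree q) where
  open TreeNotions X

  ~-sym : ∀ {x y} → x ~ y → y ~ x
  ~-sym {x} {y} = subst T (adj-sym x y)

  ∥-isEquivalence : IsEquivalence _∥_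
  ∥-isEquivalence = record
    { refl  = 0 , 0 , λ i → refl
    ; sym   = λ (k , m , h) → m , k , λ i → sym (h i)
    ; trans = λ {r} {s} {t} (k , m , h) (k′ , m′ , h′) →
        k ℕ.+ k′ , m′ ℕ.+ m , λ i → begin
          r (k ℕ.+ k′ ℕ.+ i)   ≡⟨ cong r (ℕP.+-assoc k k′ i) ⟩
          r (k ℕ.+ (k′ ℕ.+ i)) ≡⟨ h (k′ ℕ.+ i) ⟩
          s (m ℕ.+ (k′ ℕ.+ i)) ≡⟨ cong s (x∙yz≈y∙xz m k′ i) ⟩
          s (k′ ℕ.+ (m ℕ.+ i)) ≡⟨ h′ (m ℕ.+ i) ⟩
          t (m′ ℕ.+ (m ℕ.+ i)) ≡⟨ cong t (ℕP.+-assoc m′ m i) ⟨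
          t (m′ ℕ.+ m ℕ.+ i)   ∎
    }
    where open ≡-Reasoning

  ∥-setoid : Setoid 0ℓ 0ℓ
  ∥-setoid = record { isEquivalence = ∥-isEquivalence }

  module ∥-Reasoning = SetoidReasoning ∥-setoid

  ∥-sym : ∀ r s → r ∥ s → s ∥ r
  ∥-sym r s = IsEquivalence.sym ∥-isEquivalence {r} {s}

  ∥-trans : ∀ r s t → r ∥ s → s ∥ t → r ∥ t
  ∥-trans r s t = IsEquivalence.trans ∥-isEquivalence {r} {s} {t}

  ≗⇒∥ : ∀ {r s} → (∀ i → r i ≡ s i) → r ∥ s
  ≗⇒∥ e = 0 , 0 , λ i → e i

  drop : ℕ → (ℕ → V) → ℕ → V
  drop t r i = r (t ℕ.+ i)

  drop-∥ : ∀ t r → drop t r ∥ r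
  drop-∥ t r = 0 , t , λ i → refl

  _◂_ : V → (ℕ → V) → ℕ → V
  (x ◂ r) zero    = x
  (x ◂ r) (suc i) = r i

  ◂-∥ : ∀ x r → (x ◂ r) ∥ r
  ◂-∥ x r = 1 , 0 , λ i → refl

  bwd-shift-∥ : ∀ (l : ℤ → V) c → bwd (λ j → l (j ℤ.+ c)) ∥ bwd l
  bwd-shift-∥ l (+ α)    = α , 0 , λ i → cong l (cancel (+ α) (+ i))
    where
      cancel : ∀ a b → - (a ℤ.+ b) ℤ.+ a ≡ - b
      cancel = solve-∀
  bwd-shift-∥ l -[1+ α ] = 0 , suc α , λ i → cong l (combine (+ suc α) (+ i))
    where
      combine : ∀ a b → - b ℤ.+ - a ≡ - (a ℤ.+ b)
      combine = solve-∀

  ray-walk : ∀ {r} → IsRay r → ∀ n → IsReducedWalk (r 0) (r n) n r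
  ray-walk (adjacent , no-backtrack) n = refl , refl , (λ i _ → adjacent i) , (λ i _ → no-backtrack i)

  ray-drop : ∀ {r} → IsRay r → ∀ t → IsRay (drop t r)
  ray-drop {r} (adjacent , no-backtrack) t =
      (λ i → subst (λ j → r (t ℕ.+ i) ~ r j) (sym (ℕP.+-suc t i)) (adjacent (t ℕ.+ i)))
    , (λ i e → no-backtrack (t ℕ.+ i) (trans e (cong r (trans (ℕP.+-suc t (suc i)) (cong suc (ℕP.+-suc t i))))))

  ray-◂ : ∀ {x r} → IsRay r → x ~ r 0 → x ≢ r 1 → IsRay (x ◂ r)
  ray-◂ (adjacent , no-backtrack) x~r₀ x≢r₁ =
      (λ { zero → x~r₀ ; (suc i) → adjacent i })
    , (λ { zero → x≢r₁ ; (suc i) → no-backtrack i })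

  ray-unique : ∀ {r s} → IsRay r → IsRay s → r 0 ≡ s 0 → r ∥ s → ∀ i → r i ≡ s i
  ray-unique {r} {s} ray-r ray-s r₀≡s₀ (k , m , h) = agree
    where
      open ≡-Reasoning
      rₖ≡sₘ : r k ≡ s m
      rₖ≡sₘ = subst₂ (λ a b → r a ≡ s b) (ℕP.+-identityʳ k) (ℕP.+-identityʳ m) (h 0)

      s-walk : IsReducedWalk (r 0) (r k) m s
      s-walk with ray-walk ray-s m
      ... | start , end , adjacent , no-backtrack =
        trans start (sym r₀≡s₀) , trans end (sym rₖ≡sₘ) , adjacent , no-backtrack

      walks-agree : k ≡ m × (∀ i → i ℕ.≤ k → r i ≡ s i)
      walks-agree = walk-unique (r 0) (r k) k m r s (ray-walk ray-r k) s-walk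

      agree : ∀ i → r i ≡ s i
      agree i with ℕP.≤-total i k
      ... | inj₁ i≤k = proj₂ walks-agree i i≤k
      ... | inj₂ k≤i = begin
        r i                   ≡⟨ cong r (ℕP.m+[n∸m]≡n k≤i) ⟨
        r (k ℕ.+ (i ℕ.∸ k))   ≡⟨ h (i ℕ.∸ k) ⟩
        s (m ℕ.+ (i ℕ.∸ k))   ≡⟨ cong (λ n → s (n ℕ.+ (i ℕ.∸ k))) (proj₁ walks-agree) ⟨
        s (k ℕ.+ (i ℕ.∸ k))   ≡⟨ cong s (ℕP.m+[n∸m]≡n k≤i) ⟩
        s i                   ∎

  ray-no-return : ∀ {r} → IsRay r → ∀ t → r 0 ≡ r t → t ≡ 0
  ray-no-return {r} ray-r t r₀≡rₜ =
    proj₁ (walk-unique (r 0) (r 0) t 0 r (λ _ → r 0) loop (refl , refl , (λ _ ()) , (λ _ ())))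
    where
      loop : IsReducedWalk (r 0) (r 0) t r
      loop with ray-walk ray-r t
      ... | start , end , adjacent , no-backtrack = start , trans end (sym r₀≡rₜ) , adjacent , no-backtrack

  ray-injective-≤ : ∀ {r} → IsRay r → ∀ {a b} → a ℕ.≤ b → r a ≡ r b → a ≡ b
  ray-injective-≤ {r} ray-r {a} {b} a≤b same-vertex = ℕP.≤-antisym a≤b (ℕP.m∸n≡0⇒m≤n no-return)
    where
      no-return : b ℕ.∸ a ≡ 0
      no-return = ray-no-return (ray-drop ray-r a) (b ℕ.∸ a)
        (trans (cong r (ℕP.+-identityʳ a)) (trans same-vertex (cong r (sym (ℕP.m+[n∸m]≡n a≤b)))))

  ray-injective : ∀ {r} → IsRay r → ∀ {a b} → r a ≡ r b → a ≡ b
  ray-injective ray-r {a} {b} same-vertex with ℕP.≤-total a b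
  ... | inj₁ a≤b = ray-injective-≤ ray-r a≤b same-vertex
  ... | inj₂ b≤a = sym (ray-injective-≤ ray-r b≤a (sym same-vertex))

  IsRay-≗ : ∀ {r s} → (∀ i → r i ≡ s i) → IsRay r → IsRay s
  IsRay-≗ r≗s (adjacent , no-backtrack) =
      (λ i → subst₂ _~_ (r≗s i) (r≗s (suc i)) (adjacent i))
    , (λ i e → no-backtrack i (trans (r≗s i) (trans e (sym (r≗s (suc (suc i)))))))

  infixr 31 _∘ᴬ_
  infix  32 _⁻¹ᴬ
  infixr 30 _·_

  _∘ᴬ_ : Aut X → Aut X → Aut X
  g ∘ᴬ h = record
    { fun     = λ x → fun g (fun h x)
    ; inv     = λ x → inv h (inv g x)
    ; inv-fun = λ x → trans (cong (inv h) (inv-fun g (fun h x))) (inv-fun h x)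
    ; fun-inv = λ x → trans (cong (fun g) (fun-inv h (inv g x))) (fun-inv g x)
    ; pres    = λ x y → trans (pres g (fun h x) (fun h y)) (pres h x y)
    }

  _⁻¹ᴬ : Aut X → Aut X
  g ⁻¹ᴬ = record
    { fun     = inv g
    ; inv     = fun g
    ; inv-fun = fun-inv g
    ; fun-inv = inv-fun g
    ; pres    = λ x y → trans (sym (pres g (inv g x) (inv g y))) (cong₂ adj (fun-inv g x) (fun-inv g y))
    }

  _·_ : Aut X → (ℕ → V) → ℕ → V
  (g · r) i = fun g (r i)

  ·-IsRay : ∀ g {r} → IsRay r → IsRay (g · r)
  ·-IsRay g {r} (adjacent , no-backtrack) =
      (λ i → subst T (sym (pres g (r i) (r (suc i)))) (adjacent i))
    , (λ i e → no-backtrack i (trans (sym (inv-fun g _)) (trans (cong (inv g) e) (inv-fun g _))))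

  ·-∥ : ∀ g r s → r ∥ s → g · r ∥ g · s
  ·-∥ g r s (k , m , h) = k , m , λ i → cong (fun g) (h i)

module Horocycles {q : ℕ} (X : Tree q) (v : ℤ → Tree.V X) (v-line : TreeNotions.IsLine X v)
                  (em : ExcludedMiddle) where
  open TreeNotions X
  open Relative v
  open TreeFacts X

  v-from : ℤ → ℕ → V
  v-from j i = v (j ℤ.+ + i)

  v-from-RayTo∞ : ∀ j → RayTo∞ (v j) (v-from j)
  v-from-RayTo∞ j =
      ( (λ i → subst (λ a → v (j ℤ.+ + i) ~ v a) (one-more j (+ i)) (proj₁ v-line (j ℤ.+ + i)))
      , (λ i e → proj₂ v-line (j ℤ.+ + i) (trans e (cong v (two-more j (+ i))))) )
    , cong v (ℤP.+-identityʳ j)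
    , parallel j
    where
      one-more : ∀ a b → 1ℤ ℤ.+ (a ℤ.+ b) ≡ a ℤ.+ (1ℤ ℤ.+ b)
      one-more = solve-∀
      two-more : ∀ a b → a ℤ.+ (1ℤ ℤ.+ (1ℤ ℤ.+ b)) ≡ 1ℤ ℤ.+ (1ℤ ℤ.+ (a ℤ.+ b))
      two-more = solve-∀
      cancel : ∀ a b → - a ℤ.+ (a ℤ.+ b) ≡ b
      cancel = solve-∀
      parallel : ∀ j → v-from j ∥ ray∞
      parallel (+ a)    = 0 , a , λ i → refl
      parallel -[1+ a ] = suc a , 0 , λ i → cong v (cancel (+ suc a) (+ i))

  ray∞-RayTo∞ : RayTo∞ (v (+ 0)) ray∞
  ray∞-RayTo∞ = v-from-RayTo∞ (+ 0)

  RayTo∞-step : ∀ {x y r} → x ~ y → RayTo∞ y r → ∃ (RayTo∞ x)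
  RayTo∞-step {x} {r = r} x~y (ray-r , r₀≡y , r∥∞) with em (x ≡ r 1)
  ... | yes x≡r₁ = drop 1 r , ray-drop ray-r 1 , sym x≡r₁ , (begin drop 1 r ≈⟨ drop-∥ 1 r ⟩ r ≈⟨ r∥∞ ⟩ ray∞ ∎)
    where open ∥-Reasoning
  ... | no x≢r₁ =
    x ◂ r , ray-◂ ray-r (subst (x ~_) (sym r₀≡y) x~y) x≢r₁ , refl , (begin x ◂ r ≈⟨ ◂-∥ x r ⟩ r ≈⟨ r∥∞ ⟩ ray∞ ∎)
    where open ∥-Reasoning

  RayTo∞-exists : ∀ u → ∃ (RayTo∞ u)
  RayTo∞-exists u with walk-exists u (v (+ 0))
  ... | n , f , f₀≡u , fₙ≡v₀ , adjacent , _ = subst (λ x → ∃ (RayTo∞ x)) f₀≡u (along n f adjacent fₙ≡v₀)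
    where
      along : ∀ n f → (∀ i → suc i ℕ.≤ n → f i ~ f (suc i)) → f n ≡ v (+ 0) → ∃ (RayTo∞ (f 0))
      along zero    f _        f₀≡v₀ = ray∞ , subst (λ x → RayTo∞ x ray∞) (sym f₀≡v₀) ray∞-RayTo∞
      along (suc n) f adjacent fₙ≡v₀ = RayTo∞-step (adjacent 0 (s≤s z≤n))
        (proj₂ (along n (λ i → f (suc i)) (λ i i<n → adjacent (suc i) (s≤s i<n)) fₙ≡v₀))

  abstract
    ray : V → ℕ → V
    ray u = proj₁ (RayTo∞-exists u)

    ray-RayTo∞ : ∀ u → RayTo∞ u (ray u)
    ray-RayTo∞ u = proj₂ (RayTo∞-exists u)

  RayTo∞-unique : ∀ {u r} → RayTo∞ u r → ∀ i → r i ≡ ray u i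
  RayTo∞-unique {u} {r} (ray-r , r₀≡u , r∥∞) =
    ray-unique ray-r ray-u (trans r₀≡u (sym u₀≡u)) (begin r ≈⟨ r∥∞ ⟩ ray∞ ≈⟨ u∥∞ ⟨ ray u ∎)
    where
      open ∥-Reasoning
      ray-u = proj₁ (ray-RayTo∞ u)
      u₀≡u = proj₁ (proj₂ (ray-RayTo∞ u))
      u∥∞ = proj₂ (proj₂ (ray-RayTo∞ u))

  parent : V → V
  parent u = ray u 1

  ancestor : ℕ → V → V
  ancestor zero    u = u
  ancestor (suc t) u = ancestor t (parent u)

  ancestors : V → ℕ → V
  ancestors u t = ancestor t u

  RayTo∞-drop : ∀ {u r} → RayTo∞ u r → ∀ t → RayTo∞ (r t) (drop t r)
  RayTo∞-drop {r = r} (ray-r , _ , r∥∞) t =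
    ray-drop ray-r t , cong r (ℕP.+-identityʳ t) , (begin drop t r ≈⟨ drop-∥ t r ⟩ r ≈⟨ r∥∞ ⟩ ray∞ ∎)
    where open ∥-Reasoning

  RayTo∞-follows-parents : ∀ {u r} → RayTo∞ u r → ∀ t → r t ≡ ancestor t u
  RayTo∞-follows-parents (_ , r₀≡u , _) zero = r₀≡u
  RayTo∞-follows-parents R (suc t) =
    trans (RayTo∞-follows-parents (RayTo∞-drop R 1) t) (cong (ancestor t) (RayTo∞-unique R 1))

  ancestors-RayTo∞ : ∀ u → RayTo∞ u (ancestors u)
  ancestors-RayTo∞ u with ray-RayTo∞ u
  ... | R@(ray-u , _ , u∥∞) =
      IsRay-≗ (RayTo∞-follows-parents R) ray-u , refl
    , (begin ancestors u ≈⟨ ≗⇒∥ (RayTo∞-follows-parents R) ⟨ ray u ≈⟨ u∥∞ ⟩ ray∞ ∎)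
    where open ∥-Reasoning

  parent-~ : ∀ x → x ~ parent x
  parent-~ x = proj₁ (proj₁ (ancestors-RayTo∞ x)) 0

  grandparent-≢ : ∀ x → x ≢ parent (parent x)
  grandparent-≢ x = proj₂ (proj₁ (ancestors-RayTo∞ x)) 0

  ancestor-+ : ∀ s t x → ancestor (s ℕ.+ t) x ≡ ancestor t (ancestor s x)
  ancestor-+ zero    t x = refl
  ancestor-+ (suc s) t x = ancestor-+ s t (parent x)

  ancestor-comm : ∀ s t x → ancestor s (ancestor t x) ≡ ancestor t (ancestor s x)
  ancestor-comm s t x =
    trans (sym (ancestor-+ t s x)) (trans (cong (λ n → ancestor n x) (ℕP.+-comm t s)) (ancestor-+ s t x))

  ancestor-parent : ∀ t x → ancestor t (parent x) ≡ parent (ancestor t x)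
  ancestor-parent t x = ancestor-comm t 1 x

  ancestor-v : ∀ t j → ancestor t (v j) ≡ v (j ℤ.+ + t)
  ancestor-v t j = sym (RayTo∞-follows-parents (v-from-RayTo∞ j) t)

  Up⇒parent : ∀ {x y} → Up x y → y ≡ parent x
  Up⇒parent (_ , R , r₁≡y) = trans (sym r₁≡y) (RayTo∞-follows-parents R 1)

  adjacent⇒parent-or-child : ∀ {x y} → x ~ y → y ≡ parent x ⊎ x ≡ parent y
  adjacent⇒parent-or-child {x} {y} x~y with em (x ≡ parent y)
  ... | yes x≡py = inj₂ x≡py
  ... | no x≢py = inj₁ (Up⇒parent (x ◂ ancestors y , R , refl))
    where
      open ∥-Reasoning
      R : RayTo∞ x (x ◂ ancestors y)
      R with ancestors-RayTo∞ y
      ... | ray-y , _ , y∥∞ = ray-◂ ray-y x~y x≢py , refl , (begin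
        x ◂ ancestors y ≈⟨ ◂-∥ x (ancestors y) ⟩
        ancestors y     ≈⟨ y∥∞ ⟩
        ray∞            ∎)

  Down⇒child : ∀ {x y} → Down x y → parent y ≡ x
  Down⇒child {x} (x~y , not-up) with adjacent⇒parent-or-child x~y
  ... | inj₁ y≡px = ⊥-elim (not-up (ancestors x , ancestors-RayTo∞ x , sym y≡px))
  ... | inj₂ x≡py = sym x≡py

  child-Down : ∀ z → Down (parent z) z
  child-Down z = ~-sym (parent-~ z) , λ up → grandparent-≢ z (Up⇒parent up)

  parent-preserving⇒~-preserving : ∀ {f : V → V} → (∀ u → parent (f u) ≡ f (parent u)) → ∀ {x y} → x ~ y → f x ~ f y
  parent-preserving⇒~-preserving {f} f-parent {x} {y} x~y with adjacent⇒parent-or-child x~y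
  ... | inj₁ y≡px = subst (f x ~_) (trans (f-parent x) (cong f (sym y≡px))) (parent-~ (f x))
  ... | inj₂ x≡py = subst (_~ f y) (trans (f-parent y) (cong f (sym x≡py))) (~-sym (parent-~ (f y)))

  anchor : ∀ u → ∃₂ λ k m → ancestor k u ≡ v (+ m)
  anchor u with proj₂ (proj₂ (ancestors-RayTo∞ u))
  ... | k , m , h = k , m , subst₂ (λ a b → ancestor a u ≡ v (+ b)) (ℕP.+-identityʳ k) (ℕP.+-identityʳ m) (h 0)

  level : V → ℤ
  level u = + proj₁ (proj₂ (anchor u)) - + proj₁ (anchor u)

  ancestor-anchored : ∀ u k {m} → ancestor k u ≡ v (+ m) → ∀ t → ancestor (k ℕ.+ t) u ≡ v (+ (m ℕ.+ t))
  ancestor-anchored u k {m} aₖ≡vₘ t = trans (ancestor-+ k t u) (trans (cong (ancestor t) aₖ≡vₘ) (ancestor-v t (+ m)))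

  private
    cross-sum⇒difference : ∀ a b c d → a ℤ.+ d ≡ c ℤ.+ b → a - b ≡ c - d
    cross-sum⇒difference a b c d e = trans (shift a b d) (trans (cong (_- (b ℤ.+ d)) e) (unshift c b d))
      where
        shift : ∀ a b d → a - b ≡ (a ℤ.+ d) - (b ℤ.+ d)
        shift = solve-∀
        unshift : ∀ c b d → (c ℤ.+ b) - (b ℤ.+ d) ≡ c - d
        unshift = solve-∀

    difference⇒cross-sum : ∀ a b c d → a - b ≡ c - d → a ℤ.+ d ≡ c ℤ.+ b
    difference⇒cross-sum a b c d e = trans (shift a b d) (trans (cong (ℤ._+ (b ℤ.+ d)) e) (unshift c b d))
      where
        shift : ∀ a b d → a ℤ.+ d ≡ (a - b) ℤ.+ (b ℤ.+ d)
        shift = solve-∀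
        unshift : ∀ c b d → (c - d) ℤ.+ (b ℤ.+ d) ≡ c ℤ.+ b
        unshift = solve-∀

  level-unique : ∀ u k {m} → ancestor k u ≡ v (+ m) → level u ≡ + m - + k
  level-unique u k {m} aₖ≡vₘ =
    cross-sum⇒difference (+ m′) (+ k′) (+ m) (+ k) (cong +_ (ray-injective (proj₁ ray∞-RayTo∞) same-vertex))
    where
      open ≡-Reasoning
      k′ = proj₁ (anchor u)
      m′ = proj₁ (proj₂ (anchor u))
      aₖ′≡vₘ′ = proj₂ (proj₂ (anchor u))

      same-vertex : v (+ (m′ ℕ.+ k)) ≡ v (+ (m ℕ.+ k′))
      same-vertex = begin
        v (+ (m′ ℕ.+ k))       ≡⟨ ancestor-anchored u k′ aₖ′≡vₘ′ k ⟨
        ancestor (k′ ℕ.+ k) u  ≡⟨ cong (λ n → ancestor n u) (ℕP.+-comm k′ k) ⟩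
        ancestor (k ℕ.+ k′) u  ≡⟨ ancestor-anchored u k aₖ≡vₘ k′ ⟩
        v (+ (m ℕ.+ k′))       ∎

  level-ancestor : ∀ t u → level (ancestor t u) ≡ level u ℤ.+ + t
  level-ancestor t u = begin
    level (ancestor t u)  ≡⟨ level-unique (ancestor t u) k (trans (ancestor-comm k t u) (ancestor-anchored′ t)) ⟩
    + (m ℕ.+ t) - + k     ≡⟨ rearrange (+ m) (+ k) (+ t) ⟩
    level u ℤ.+ + t       ∎
    where
      open ≡-Reasoning
      k = proj₁ (anchor u)
      m = proj₁ (proj₂ (anchor u))
      aₖ≡vₘ = proj₂ (proj₂ (anchor u))
      ancestor-anchored′ : ∀ t → ancestor t (ancestor k u) ≡ v (+ (m ℕ.+ t))
      ancestor-anchored′ t = trans (cong (ancestor t) aₖ≡vₘ) (ancestor-v t (+ m))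
      rearrange : ∀ a b c → (a ℤ.+ c) - b ≡ (a - b) ℤ.+ c
      rearrange = solve-∀

  level-parent : ∀ u → level (parent u) ≡ level u ℤ.+ 1ℤ
  level-parent = level-ancestor 1

  level-v : ∀ j → level (v j) ≡ j
  level-v (+ a)    = trans (level-unique (v (+ a)) 0 refl) (ℤP.+-identityʳ (+ a))
  level-v -[1+ a ] =
    level-unique (v -[1+ a ]) (suc a) (trans (ancestor-v (suc a) -[1+ a ]) (cong v (ℤP.+-inverseˡ (+ suc a))))

  same-level⇒common-ancestor : ∀ {x y} → level x ≡ level y → ∃ λ T → ancestor T x ≡ ancestor T y
  same-level⇒common-ancestor {x} {y} ℓx≡ℓy = k ℕ.+ k′ , (begin
      ancestor (k ℕ.+ k′) x  ≡⟨ ancestor-anchored x k aₖ≡vₘ k′ ⟩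
      v (+ (m ℕ.+ k′))       ≡⟨ cong v (difference⇒cross-sum (+ m) (+ k) (+ m′) (+ k′) ℓx≡ℓy) ⟩
      v (+ (m′ ℕ.+ k))       ≡⟨ ancestor-anchored y k′ aₖ′≡vₘ′ k ⟨
      ancestor (k′ ℕ.+ k) y  ≡⟨ cong (λ n → ancestor n y) (ℕP.+-comm k′ k) ⟩
      ancestor (k ℕ.+ k′) y  ∎)
    where
      open ≡-Reasoning
      k = proj₁ (anchor x)
      m = proj₁ (proj₂ (anchor x))
      aₖ≡vₘ = proj₂ (proj₂ (anchor x))
      k′ = proj₁ (anchor y)
      m′ = proj₁ (proj₂ (anchor y))
      aₖ′≡vₘ′ = proj₂ (proj₂ (anchor y))

  common-ancestor⇒same-level : ∀ {x y} T → ancestor T x ≡ ancestor T y → level x ≡ level y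
  common-ancestor⇒same-level {x} {y} T e = ∙-cancelʳ (+ T) (level x) (level y)
    (trans (sym (level-ancestor T x)) (trans (cong level e) (level-ancestor T y)))

  same-level⇒SameHoro : ∀ {x y} → level x ≡ level y → SameHoro x y
  same-level⇒SameHoro {x} {y} ℓx≡ℓy with same-level⇒common-ancestor ℓx≡ℓy
  ... | T , aₜx≡aₜy = ancestors x , ancestors y , ancestors-RayTo∞ x , ancestors-RayTo∞ y , T , λ i →
    trans (ancestor-+ T i x) (trans (cong (ancestor i) aₜx≡aₜy) (sym (ancestor-+ T i y)))

  SameHoro⇒same-level : ∀ {x y} → SameHoro x y → level x ≡ level y
  SameHoro⇒same-level (r , r′ , R , R′ , T , h) = common-ancestor⇒same-level T (begin
    ancestor T _  ≡⟨ RayTo∞-follows-parents R T ⟨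
    r T           ≡⟨ cong r (ℕP.+-identityʳ T) ⟨
    r (T ℕ.+ 0)   ≡⟨ h 0 ⟩
    r′ (T ℕ.+ 0)  ≡⟨ cong r′ (ℕP.+-identityʳ T) ⟩
    r′ T          ≡⟨ RayTo∞-follows-parents R′ T ⟩
    ancestor T _  ∎)
    where open ≡-Reasoning

  bwd-v-∦ : ¬ bwd v ∥ ray∞
  bwd-v-∦ (k , m , h) = negative≢positive (subst (λ n → - + n ≡ + (m ℕ.+ 1)) (ℕP.+-comm k 1)
    (trans (sym (level-v _)) (trans (cong level (h 1)) (level-v _))))
    where
      negative≢positive : ∀ {n p} → -[1+ n ] ≢ + p
      negative≢positive ()

  IsParentChain : (ℤ → V) → Set
  IsParentChain l = ∀ j → parent (l j) ≡ l (ℤ.suc j)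

  IsGeodesicTo∞ : (ℤ → V) → Set
  IsGeodesicTo∞ l = IsParentChain l × (∀ j → level (l j) ≡ j)

  ancestor-chain : ∀ {l} → IsParentChain l → ∀ t j → ancestor t (l j) ≡ l (j ℤ.+ + t)
  ancestor-chain {l} chain zero    j = cong l (sym (ℤP.+-identityʳ j))
  ancestor-chain {l} chain (suc t) j =
    trans (cong (ancestor t) (chain j)) (trans (ancestor-chain chain t (ℤ.suc j)) (cong l (one-more j (+ t))))
    where
      one-more : ∀ a b → 1ℤ ℤ.+ a ℤ.+ b ≡ a ℤ.+ (1ℤ ℤ.+ b)
      one-more = solve-∀

  level-chain : ∀ {l} → IsParentChain l → ∀ j → level (l j) ≡ level (l (+ 0)) ℤ.+ j
  level-chain {l} chain (+ n)    = climb n (+ 0)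
    where
      climb : ∀ t j → level (l (j ℤ.+ + t)) ≡ level (l j) ℤ.+ + t
      climb t j = trans (cong level (sym (ancestor-chain chain t j))) (level-ancestor t (l j))
  level-chain {l} chain -[1+ n ] = isolate (level (l -[1+ n ])) (level (l (+ 0))) (+ suc n) (begin
      level (l (+ 0))                           ≡⟨ cong (λ j → level (l j)) (ℤP.+-inverseˡ (+ suc n)) ⟨
      level (l (-[1+ n ] ℤ.+ + suc n))          ≡⟨ cong level (ancestor-chain chain (suc n) -[1+ n ]) ⟨
      level (ancestor (suc n) (l -[1+ n ]))     ≡⟨ level-ancestor (suc n) (l -[1+ n ]) ⟩
      level (l -[1+ n ]) ℤ.+ + suc n            ∎)
    where
      open ≡-Reasoning
      isolate : ∀ a b c → b ≡ a ℤ.+ c → a ≡ b ℤ.+ - c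
      isolate a b c e = trans (cancel a c) (cong (ℤ._+ - c) (sym e))
        where
          cancel : ∀ a c → a ≡ (a ℤ.+ c) ℤ.+ - c
          cancel = solve-∀

  recentre : (ℤ → V) → ℤ → V
  recentre l j = l (j ℤ.+ - level (l (+ 0)))

  recentre-IsGeodesicTo∞ : ∀ {l} → IsParentChain l → IsGeodesicTo∞ (recentre l)
  recentre-IsGeodesicTo∞ {l} chain =
      (λ j → trans (chain _) (cong l (one-more j (- level (l (+ 0))))))
    , (λ j → trans (level-chain chain _) (cancel (level (l (+ 0))) j))
    where
      one-more : ∀ a b → 1ℤ ℤ.+ (a ℤ.+ b) ≡ 1ℤ ℤ.+ a ℤ.+ b
      one-more = solve-∀
      cancel : ∀ a j → a ℤ.+ (j ℤ.+ - a) ≡ j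
      cancel = solve-∀

  LineFrom⇒IsGeodesicTo∞ : ∀ b l → LineFrom b l → IsGeodesicTo∞ l
  LineFrom⇒IsGeodesicTo∞ b l ((adjacent , _) , _ , _ , horo) = chain , levels
    where
      levels : ∀ j → level (l j) ≡ j
      levels j = trans (SameHoro⇒same-level (horo j)) (level-v j)

      no-drop-by-two : ∀ j → j ≢ ℤ.suc (ℤ.suc j)
      no-drop-by-two j e = ℤP.<-irrefl e (ℤP.suc[i]≤j⇒i<j (ℤP.i≤suc[i] (ℤ.suc j)))

      chain : IsParentChain l
      chain j with adjacent⇒parent-or-child (adjacent j)
      ... | inj₁ up   = sym up
      ... | inj₂ down = ⊥-elim (no-drop-by-two j (begin
        j                            ≡⟨ levels j ⟨
        level (l j)                  ≡⟨ cong level down ⟩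
        level (parent (l (ℤ.suc j))) ≡⟨ level-parent (l (ℤ.suc j)) ⟩
        level (l (ℤ.suc j)) ℤ.+ 1ℤ   ≡⟨ cong (ℤ._+ 1ℤ) (levels (ℤ.suc j)) ⟩
        ℤ.suc j ℤ.+ 1ℤ               ≡⟨ ℤP.+-comm (ℤ.suc j) 1ℤ ⟩
        ℤ.suc (ℤ.suc j)              ∎))
        where open ≡-Reasoning

  geodesic-unique : ∀ {l l′} → IsGeodesicTo∞ l → IsGeodesicTo∞ l′ → bwd l ∥ bwd l′ → ∀ j → l j ≡ l′ j
  geodesic-unique {l} {l′} (chain , levels) (chain′ , levels′) (k , m , h) =
    ℤ-upward-induction (λ j → l j ≡ l′ j) k far
      (λ j lⱼ≡l′ⱼ → trans (sym (chain j)) (trans (cong parent lⱼ≡l′ⱼ) (chain′ j)))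
    where
      far : ∀ i → l (- + (k ℕ.+ i)) ≡ l′ (- + (k ℕ.+ i))
      far i = trans (h i) (cong l′ (trans (sym (levels′ _)) (trans (cong level (sym (h i))) (levels _))))

  IsDescending : (ℕ → V) → Set
  IsDescending s = ∀ t → parent (s (suc t)) ≡ s t

  descending-from-start : ∀ {s} → IsRay s → parent (s 1) ≡ s 0 → IsDescending s
  descending-from-start ray-s start zero = start
  descending-from-start ray-s@(adjacent , no-backtrack) start (suc t) with adjacent⇒parent-or-child (adjacent (suc t))
  ... | inj₁ up   = ⊥-elim (no-backtrack t (trans (sym (descending-from-start ray-s start t)) (sym up)))
  ... | inj₂ down = sym down

  climbing⇒ancestors : ∀ (r : ℕ → V) → (∀ i → r (suc i) ≡ parent (r i)) → ∀ i → r i ≡ ancestor i (r 0)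
  climbing⇒ancestors r climbs zero    = refl
  climbing⇒ancestors r climbs (suc i) =
    trans (climbs i) (trans (cong parent (climbing⇒ancestors r climbs i)) (sym (ancestor-parent i (r 0))))

  eventually-descending : ∀ {r} → IsRay r → ¬ r ∥ ray∞ → ∃ λ i₀ → IsDescending (drop i₀ r)
  eventually-descending {r} ray-r@(adjacent , _) r∦∞ with em (∃ λ i → parent (r (suc i)) ≡ r i)
  ... | yes (i₀ , down) = i₀ , descending-from-start (ray-drop ray-r i₀)
          (subst₂ (λ a b → parent (r a) ≡ r b) (ℕP.+-comm 1 i₀) (sym (ℕP.+-identityʳ i₀)) down)
  ... | no never-down = ⊥-elim (r∦∞ (begin
          r               ≈⟨ ≗⇒∥ (climbing⇒ancestors r climbs) ⟩
          ancestors (r 0) ≈⟨ proj₂ (proj₂ (ancestors-RayTo∞ (r 0))) ⟩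
          ray∞            ∎))
    where
      open ∥-Reasoning
      climbs : ∀ i → r (suc i) ≡ parent (r i)
      climbs i with adjacent⇒parent-or-child (adjacent i)
      ... | inj₁ up   = up
      ... | inj₂ down = ⊥-elim (never-down (i , sym down))

  descending-line : (ℕ → V) → ℤ → V
  descending-line s (+ t)     = ancestor t (s 0)
  descending-line s -[1+ n ]  = s (suc n)

  descending-line-IsParentChain : ∀ {s} → IsDescending s → IsParentChain (descending-line s)
  descending-line-IsParentChain {s} descending (+ t)          = sym (ancestor-parent t (s 0))
  descending-line-IsParentChain     descending -[1+ zero ]    = descending 0
  descending-line-IsParentChain     descending -[1+ suc n ]   = descending (suc n)

  bwd-descending-line-∥ : ∀ s → bwd (descending-line s) ∥ s
  bwd-descending-line-∥ s = 1 , 1 , λ i → refl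

  geodesic-towards : ∀ {r} → IsRay r → ¬ r ∥ ray∞ → ∃ λ l → IsGeodesicTo∞ l × bwd l ∥ r
  geodesic-towards {r} ray-r r∦∞ with eventually-descending ray-r r∦∞
  ... | i₀ , descending = recentre l , recentre-IsGeodesicTo∞ (descending-line-IsParentChain descending) , (begin
      bwd (recentre l) ≈⟨ bwd-shift-∥ l _ ⟩
      bwd l            ≈⟨ bwd-descending-line-∥ (drop i₀ r) ⟩
      drop i₀ r        ≈⟨ drop-∥ i₀ r ⟩
      r                ∎)
    where
      open ∥-Reasoning
      l = descending-line (drop i₀ r)

module Coordinates {q : ℕ} (D : Setup q) (em : ExcludedMiddle) where
  open Setup D
  open TreeNotions X
  open TreeFacts X
  open Horocycles X v v-line em
  open Ring R using (Carrier; _≈_; 0#; +-cong; +-assoc; +-identityˡ; +-identityʳ; -‿cong; -‿inverseˡ; -‿inverseʳ)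
    renaming (_+_ to _⊕_; -_ to ⊝_; refl to ≈-refl; sym to ≈-sym; trans to ≈-trans; reflexive to ≈-reflexive)
  open RingProperties R using (-0#≈0#)
  module ≈-Reasoning = SetoidReasoning (Ring.setoid R)

  coord : V → ℕ → Carrier
  coord z t = lab (parent (ancestor t z)) (ancestor t z)

  lab-below-v : ∀ b → lab (parent (v b)) (v b) ≈ 0#
  lab-below-v b = ≈-trans (≈-reflexive (cong₂ lab (ancestor-v 1 b) (cong v (sym (back b))))) (lab-line (b ℤ.+ 1ℤ))
    where
      back : ∀ b → (b ℤ.+ 1ℤ) - 1ℤ ≡ b
      back = solve-∀

  coord-anchored : ∀ z T {a} → ancestor T z ≡ v a → ∀ t → T ℕ.≤ t → coord z t ≈ 0#
  coord-anchored z T {a} aₜ≡vₐ t T≤t = ≈-trans (≈-reflexive (cong (λ x → lab (parent x) x) aₜ≡v)) (lab-below-v _)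
    where
      aₜ≡v : ancestor t z ≡ v (a ℤ.+ + (t ℕ.∸ T))
      aₜ≡v = begin
        ancestor t z                    ≡⟨ cong (λ n → ancestor n z) (ℕP.m+[n∸m]≡n T≤t) ⟨
        ancestor (T ℕ.+ (t ℕ.∸ T)) z    ≡⟨ ancestor-+ T (t ℕ.∸ T) z ⟩
        ancestor (t ℕ.∸ T) (ancestor T z) ≡⟨ cong (ancestor (t ℕ.∸ T)) aₜ≡vₐ ⟩
        ancestor (t ℕ.∸ T) (v a)        ≡⟨ ancestor-v (t ℕ.∸ T) a ⟩
        v (a ℤ.+ + (t ℕ.∸ T))           ∎
        where open ≡-Reasoning

  coord-v : ∀ j t → coord (v j) t ≈ 0#
  coord-v j t = coord-anchored (v j) 0 refl t z≤n

  coord-eventually-0 : ∀ z → ∃ λ T → ∀ t → T ℕ.≤ t → coord z t ≈ 0#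
  coord-eventually-0 z with same-level⇒common-ancestor (sym (level-v (level z)))
  ... | T , aₜ≡aₜv = T , coord-anchored z T (trans aₜ≡aₜv (ancestor-v T (level z)))

  coordinates-determine : ∀ {x y} → level x ≡ level y → (∀ t → coord x t ≈ coord y t) → x ≡ y
  coordinates-determine {x} {y} ℓx≡ℓy cx≈cy = descend (proj₁ common) (proj₂ common)
    where
      common = same-level⇒common-ancestor ℓx≡ℓy
      descend : ∀ T → ancestor T x ≡ ancestor T y → x ≡ y
      descend zero    e = e
      descend (suc T) e = descend T (lab-inj (parent xₜ) xₜ yₜ (child-Down xₜ)
          (subst (λ p → Down p yₜ) (sym same-parent) (child-Down yₜ))
          (≈-trans (cx≈cy T) (≈-reflexive (cong (λ p → lab p yₜ) (sym same-parent)))))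
        where
          xₜ = ancestor T x
          yₜ = ancestor T y
          same-parent : parent xₜ ≡ parent yₜ
          same-parent = trans (sym (ancestor-parent T x)) (trans e (ancestor-parent T y))

  child : V → Carrier → V
  child x a = proj₁ (lab-surj x a)

  parent-child : ∀ x a → parent (child x a) ≡ x
  parent-child x a = Down⇒child (proj₁ (proj₂ (lab-surj x a)))

  lab-child : ∀ x a → lab x (child x a) ≈ a
  lab-child x a = proj₂ (proj₂ (lab-surj x a))

  descendant : ℕ → (ℕ → Carrier) → V → V
  descendant zero    d x = x
  descendant (suc n) d x = descendant n d (child x (d n))

  ancestor-descendant : ∀ n d x → ancestor n (descendant n d x) ≡ x
  ancestor-descendant zero    d x = refl
  ancestor-descendant (suc n) d x = begin
    ancestor (suc n) (descendant n d y)    ≡⟨ ancestor-parent n (descendant n d y) ⟩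
    parent (ancestor n (descendant n d y)) ≡⟨ cong parent (ancestor-descendant n d y) ⟩
    parent y                               ≡⟨ parent-child x (d n) ⟩
    x                                      ∎
    where
      open ≡-Reasoning
      y = child x (d n)

  coord-descendant : ∀ n d x t → t ℕ.< n → coord (descendant n d x) t ≈ d t
  coord-descendant (suc n) d x t t<1+n with ℕP.m≤n⇒m<n∨m≡n (ℕP.≤-pred t<1+n)
  ... | inj₁ t<n  = coord-descendant n d (child x (d n)) t t<n
  ... | inj₂ refl = ≈-trans (≈-reflexive (cong (λ z → lab (parent z) z) (ancestor-descendant n d y)))
                            (≈-trans (≈-reflexive (cong (λ p → lab p y) (parent-child x (d n)))) (lab-child x (d n)))
    where y = child x (d n)

  realise-coordinates : ∀ j (d : ℕ → Carrier) K → (∀ t → K ℕ.≤ t → d t ≈ 0#) →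
            ∃ λ x → level x ≡ j × (∀ t → coord x t ≈ d t)
  realise-coordinates j d K d-vanishes = x , level-x , coord-x
    where
      x = descendant K d (v (j ℤ.+ + K))
      level-x : level x ≡ j
      level-x = ∙-cancelʳ (+ K) (level x) j
        (trans (sym (level-ancestor K x)) (trans (cong level (ancestor-descendant K d _)) (level-v _)))
      coord-x : ∀ t → coord x t ≈ d t
      coord-x t with t ℕ.<? K
      ... | yes t<K = coord-descendant K d _ t t<K
      ... | no  t≮K = ≈-trans (coord-anchored x K (ancestor-descendant K d _) t (ℕP.≮⇒≥ t≮K))
                              (≈-sym (d-vanishes t (ℕP.≮⇒≥ t≮K)))

  record Translation : Set where
    field
      shift          : ℤ → Carrier
      bound          : ℤ
      shift-vanishes : ∀ i → bound ℤ.≤ i → shift i ≈ 0#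
  open Translation

  private
    i≤+∣i∣ : ∀ i → i ℤ.≤ + ℤ.∣ i ∣
    i≤+∣i∣ (+ n)    = ℤP.≤-refl
    i≤+∣i∣ -[1+ n ] = ℤ.-≤+

    beyond-distance : ∀ a b t → ℤ.∣ b - a ∣ ℕ.≤ t → b ℤ.≤ a ℤ.+ + t
    beyond-distance a b t ∣b-a∣≤t = subst (ℤ._≤ a ℤ.+ + t) (a+[b-a] a b)
      (ℤP.+-monoʳ-≤ a (ℤP.≤-trans (i≤+∣i∣ (b - a)) (ℤ.+≤+ ∣b-a∣≤t)))
      where
        a+[b-a] : ∀ a b → a ℤ.+ (b - a) ≡ b
        a+[b-a] = solve-∀

  shifted-coord : Translation → V → ℕ → Carrier
  shifted-coord τ u t = coord u t ⊕ shift τ (level u ℤ.+ + t)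

  shifted-coord-eventually-0 : ∀ τ u → ∃ λ K → ∀ t → K ℕ.≤ t → shifted-coord τ u t ≈ 0#
  shifted-coord-eventually-0 τ u = T₀ ℕ.⊔ ℤ.∣ bound τ - level u ∣ , λ t K≤t →
    ≈-trans (+-cong (coord-vanishes t (ℕP.≤-trans (ℕP.m≤m⊔n _ _) K≤t))
                    (shift-vanishes τ _ (beyond-distance (level u) (bound τ) t (ℕP.≤-trans (ℕP.m≤n⊔m _ _) K≤t))))
            (+-identityˡ 0#)
    where
      T₀ = proj₁ (coord-eventually-0 u)
      coord-vanishes = proj₂ (coord-eventually-0 u)

  abstract
    translated : ∀ τ u → ∃ λ x → level x ≡ level u × (∀ t → coord x t ≈ shifted-coord τ u t)
    translated τ u = realise-coordinates (level u) (shifted-coord τ u) _ (proj₂ (shifted-coord-eventually-0 τ u))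

  translate : Translation → V → V
  translate τ u = proj₁ (translated τ u)

  level-translate : ∀ τ u → level (translate τ u) ≡ level u
  level-translate τ u = proj₁ (proj₂ (translated τ u))

  coord-translate : ∀ τ u t → coord (translate τ u) t ≈ coord u t ⊕ shift τ (level u ℤ.+ + t)
  coord-translate τ u = proj₂ (proj₂ (translated τ u))

  translate-cancel : ∀ τ σ → (∀ i → shift τ i ⊕ shift σ i ≈ 0#) → ∀ u → translate σ (translate τ u) ≡ u
  translate-cancel τ σ τ+σ≈0 u = coordinates-determine (trans (level-translate σ _) (level-translate τ u)) λ t → begin
    coord (translate σ (translate τ u)) t
      ≈⟨ coord-translate σ (translate τ u) t ⟩
    coord (translate τ u) t ⊕ shift σ (level (translate τ u) ℤ.+ + t)
      ≈⟨ +-cong (coord-translate τ u t) (≈-reflexive (cong (λ ℓ → shift σ (ℓ ℤ.+ + t)) (level-translate τ u))) ⟩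
    (coord u t ⊕ shift τ (level u ℤ.+ + t)) ⊕ shift σ (level u ℤ.+ + t)
      ≈⟨ +-assoc _ _ _ ⟩
    coord u t ⊕ (shift τ (level u ℤ.+ + t) ⊕ shift σ (level u ℤ.+ + t))
      ≈⟨ +-cong ≈-refl (τ+σ≈0 _) ⟩
    coord u t ⊕ 0#
      ≈⟨ +-identityʳ _ ⟩
    coord u t ∎
    where open ≈-Reasoning

  translate-parent : ∀ τ u → parent (translate τ u) ≡ translate τ (parent u)
  translate-parent τ u = coordinates-determine same-level same-coords
    where
      same-level : level (parent (translate τ u)) ≡ level (translate τ (parent u))
      same-level = begin
        level (parent (translate τ u))    ≡⟨ level-parent (translate τ u) ⟩
        level (translate τ u) ℤ.+ 1ℤ      ≡⟨ cong (ℤ._+ 1ℤ) (level-translate τ u) ⟩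
        level u ℤ.+ 1ℤ                    ≡⟨ level-parent u ⟨
        level (parent u)                  ≡⟨ level-translate τ (parent u) ⟨
        level (translate τ (parent u))    ∎
        where open ≡-Reasoning

      one-more : ∀ a b → a ℤ.+ (1ℤ ℤ.+ b) ≡ a ℤ.+ 1ℤ ℤ.+ b
      one-more = solve-∀

      same-coords : ∀ t → coord (parent (translate τ u)) t ≈ coord (translate τ (parent u)) t
      same-coords t = begin
        coord (parent (translate τ u)) t
          ≈⟨ coord-translate τ u (suc t) ⟩
        coord u (suc t) ⊕ shift τ (level u ℤ.+ + suc t)
          ≈⟨ +-cong ≈-refl (≈-reflexive (cong (shift τ) (one-more (level u) (+ t)))) ⟩
        coord (parent u) t ⊕ shift τ (level u ℤ.+ 1ℤ ℤ.+ + t)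
          ≈⟨ +-cong ≈-refl (≈-reflexive (cong (λ ℓ → shift τ (ℓ ℤ.+ + t)) (level-parent u))) ⟨
        coord (parent u) t ⊕ shift τ (level (parent u) ℤ.+ + t)
          ≈⟨ coord-translate τ (parent u) t ⟨
        coord (translate τ (parent u)) t ∎
        where open ≈-Reasoning

  negate : Translation → Translation
  negate τ = record
    { shift          = λ i → ⊝ shift τ i
    ; bound          = bound τ
    ; shift-vanishes = λ i bound≤i → ≈-trans (-‿cong (shift-vanishes τ i bound≤i)) -0#≈0#
    }

  translation : Translation → Aut X
  translation τ = record
    { fun     = translate τ
    ; inv     = translate (negate τ)
    ; inv-fun = inv-fun′
    ; fun-inv = translate-cancel (negate τ) τ (λ i → -‿inverseˡ (shift τ i))
    ; pres    = λ x y → T-⇔⇒≡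
        (λ τx~τy → subst₂ _~_ (inv-fun′ x) (inv-fun′ y)
                     (parent-preserving⇒~-preserving (translate-parent (negate τ)) τx~τy))
        (parent-preserving⇒~-preserving (translate-parent τ))
    }
    where
      inv-fun′ : ∀ x → translate (negate τ) (translate τ x) ≡ x
      inv-fun′ = translate-cancel τ (negate τ) (λ i → -‿inverseʳ (shift τ i))

  translate-fixes-v : ∀ τ j → bound τ ℤ.≤ j → translate τ (v j) ≡ v j
  translate-fixes-v τ j bound≤j = coordinates-determine (level-translate τ (v j)) same-coords
    where
      beyond-bound : ∀ t → bound τ ℤ.≤ level (v j) ℤ.+ + t
      beyond-bound t =
        ℤP.≤-trans bound≤j (subst (ℤ._≤ level (v j) ℤ.+ + t) (level-v j) (ℤP.i≤i+j (level (v j)) (+ t)))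

      same-coords : ∀ t → coord (translate τ (v j)) t ≈ coord (v j) t
      same-coords t = begin
        coord (translate τ (v j)) t                   ≈⟨ coord-translate τ (v j) t ⟩
        coord (v j) t ⊕ shift τ (level (v j) ℤ.+ + t) ≈⟨ +-cong (coord-v j t) (shift-vanishes τ _ (beyond-bound t)) ⟩
        0# ⊕ 0#                                       ≈⟨ +-identityˡ 0# ⟩
        0#                                            ≈⟨ coord-v j t ⟨
        coord (v j) t                                 ∎
        where open ≈-Reasoning

  translation-InP : ∀ τ → InP (translation τ)
  translation-InP τ = ℤ.∣ bound τ ∣ , ℤ.∣ bound τ ∣ , λ i → translate-fixes-v τ _
    (ℤP.≤-trans (i≤+∣i∣ (bound τ)) (ℤ.+≤+ (ℕP.m≤m+n ℤ.∣ bound τ ∣ i)))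

  translation-InS : ∀ τ → InS (translation τ)
  translation-InS τ = translation-InP τ , λ u → same-level⇒SameHoro (sym (level-translate τ u))

  coord-chain : ∀ {l} → IsParentChain l → ∀ j t → coord (l j) t ≡ coord (l (j ℤ.+ + t)) 0
  coord-chain chain j t = cong (λ x → lab (parent x) x) (ancestor-chain chain t j)

  coef-chain : ∀ {l} → IsParentChain l → ∀ j → coef l j ≡ coord (l (j - 1ℤ)) 0
  coef-chain {l} chain j = cong (λ x → lab x (l (j - 1ℤ))) (sym (trans (chain (j - 1ℤ)) (cong l (back j))))
    where
      back : ∀ j → 1ℤ ℤ.+ (j - 1ℤ) ≡ j
      back = solve-∀

  chain-translation : ∀ {l} → IsParentChain l → Translation
  chain-translation {l} chain = record
    { shift          = λ i → coord (l i) 0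
    ; bound          = + T₀
    ; shift-vanishes = λ { (+ n) (ℤ.+≤+ T₀≤n) →
        ≈-trans (≈-reflexive (sym (coord-chain chain (+ 0) n))) (vanishes n T₀≤n) }
    }
    where
      T₀ = proj₁ (coord-eventually-0 (l (+ 0)))
      vanishes = proj₂ (coord-eventually-0 (l (+ 0)))

  translate-v-onto-geodesic : ∀ {l} (geodesic : IsGeodesicTo∞ l) j →
                              translate (chain-translation (proj₁ geodesic)) (v j) ≡ l j
  translate-v-onto-geodesic {l} (chain , levels) j =
    coordinates-determine (trans (level-translate τ (v j)) (trans (level-v j) (sym (levels j)))) same-coords
    where
      τ = chain-translation chain
      same-coords : ∀ t → coord (translate τ (v j)) t ≈ coord (l j) t
      same-coords t = begin
        coord (translate τ (v j)) t                   ≈⟨ coord-translate τ (v j) t ⟩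
        coord (v j) t ⊕ shift τ (level (v j) ℤ.+ + t) ≈⟨ +-cong (coord-v j t) ≈-refl ⟩
        0# ⊕ coord (l (level (v j) ℤ.+ + t)) 0        ≈⟨ +-identityˡ _ ⟩
        coord (l (level (v j) ℤ.+ + t)) 0             ≡⟨ cong (λ i → coord (l (i ℤ.+ + t)) 0) (level-v j) ⟩
        coord (l (j ℤ.+ + t)) 0                       ≡⟨ coord-chain chain j t ⟨
        coord (l j) t                                 ∎
        where open ≈-Reasoning

  translation-onto-cusp : ∀ {r} → IsRay r → ¬ r ∥ ray∞ → Σ Translation λ τ → translation τ · bwd v ∥ r
  translation-onto-cusp {r} ray-r r∦∞ with geodesic-towards ray-r r∦∞
  ... | l , geodesic , bwd-l∥r = τ , (begin
    translation τ · bwd v ≈⟨ ≗⇒∥ (λ i → translate-v-onto-geodesic geodesic (- + i)) ⟩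
    bwd l                 ≈⟨ bwd-l∥r ⟩
    r                     ∎)
    where
      open ∥-Reasoning
      τ = chain-translation (proj₁ geodesic)

  translate-IsGeodesicTo∞ : ∀ τ {l} → IsGeodesicTo∞ l → IsGeodesicTo∞ (λ j → translate τ (l j))
  translate-IsGeodesicTo∞ τ {l} (chain , levels) =
      (λ j → trans (translate-parent τ (l j)) (cong (translate τ) (chain j)))
    , (λ j → trans (level-translate τ (l j)) (levels j))

  translation-InN : ∀ τ → InN (translation τ)
  translation-InN τ = translation-InS τ , (λ j → shift τ (j - 1ℤ)) , shifts-coefficients
    where
      shifts-coefficients : ∀ b → IsRay b → ¬ (b ∥ ray∞) → ∀ l l′ → LineFrom b l → LineFrom (translation τ · b) l′ →
                            ∀ j → coef l′ j ≈ (coef l j ⊕ shift τ (j - 1ℤ))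
      shifts-coefficients b _ _ l l′ line@(_ , bwd-l∥b , _) line′@(_ , bwd-l′∥τb , _) j = begin
        coef l′ j                           ≡⟨ coef-chain (proj₁ geodesic′) j ⟩
        coord (l′ (j - 1ℤ)) 0               ≡⟨ cong (λ x → coord x 0) (l′≡τl (j - 1ℤ)) ⟩
        coord (translate τ (l (j - 1ℤ))) 0  ≈⟨ coord-translate τ (l (j - 1ℤ)) 0 ⟩
        coord (l (j - 1ℤ)) 0 ⊕ shift τ (level (l (j - 1ℤ)) ℤ.+ + 0)
          ≡⟨ cong₂ _⊕_ (sym (coef-chain (proj₁ geodesic) j)) (cong (shift τ) level-below) ⟩
        coef l j ⊕ shift τ (j - 1ℤ)         ∎
        where
          open ≈-Reasoning
          geodesic = LineFrom⇒IsGeodesicTo∞ b l line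
          geodesic′ = LineFrom⇒IsGeodesicTo∞ (translation τ · b) l′ line′

          level-below : level (l (j - 1ℤ)) ℤ.+ + 0 ≡ j - 1ℤ
          level-below = trans (ℤP.+-identityʳ _) (proj₂ geodesic (j - 1ℤ))

          bwd-l′∥τ·bwd-l : bwd l′ ∥ translation τ · bwd l
          bwd-l′∥τ·bwd-l = ∥-trans (bwd l′) (translation τ · b) (translation τ · bwd l) bwd-l′∥τb
            (∥-sym (translation τ · bwd l) (translation τ · b) (·-∥ (translation τ) (bwd l) b bwd-l∥b))

          l′≡τl : ∀ j → l′ j ≡ translate τ (l j)
          l′≡τl = geodesic-unique geodesic′ (translate-IsGeodesicTo∞ τ geodesic) bwd-l′∥τ·bwd-l

module BruhatDecomposition {q : ℕ} (D : Setup q) (em : ExcludedMiddle) where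
  open Setup D
  open TreeNotions X
  open TreeFacts X
  open Horocycles X v v-line em using (ray∞-RayTo∞; bwd-v-∦)
  open Coordinates D em
    using (Translation; translate; negate; translation; translation-InP; translation-InN; translation-onto-cusp)
  open ∥-Reasoning

  InP-∘ : ∀ g h → InP g → InP h → InP (g ∘ᴬ h)
  InP-∘ g h g∈P h∈P = begin
    g · (h · ray∞) ≈⟨ ·-∥ g (h · ray∞) ray∞ h∈P ⟩
    g · ray∞       ≈⟨ g∈P ⟩
    ray∞           ∎

  InP-⁻¹ : ∀ g → InP g → InP (g ⁻¹ᴬ)
  InP-⁻¹ g g∈P = begin
    g ⁻¹ᴬ · ray∞         ≈⟨ ·-∥ (g ⁻¹ᴬ) (g · ray∞) ray∞ g∈P ⟨
    g ⁻¹ᴬ · (g · ray∞)   ≈⟨ ≗⇒∥ (λ i → inv-fun g (ray∞ i)) ⟩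
    ray∞                 ∎

  InP-cong : ∀ g h → (∀ x → fun g x ≡ fun h x) → InP g → InP h
  InP-cong g h g≗h g∈P = begin
    h · ray∞ ≈⟨ ≗⇒∥ (λ i → g≗h (ray∞ i)) ⟨
    g · ray∞ ≈⟨ g∈P ⟩
    ray∞     ∎

  InN⇒InP : ∀ g → InN g → InP g
  InN⇒InP g ((g∈P , _) , _) = g∈P

  w∉P : ¬ InP w
  w∉P w∈P = bwd-v-∦ (begin
    bwd v    ≈⟨ ≗⇒∥ (λ i → w-line (+ i)) ⟨
    w · ray∞ ≈⟨ w∈P ⟩
    ray∞     ∎)

  P∩PwP≡∅ : ∀ g → InP g → InPwP g → ⊥
  P∩PwP≡∅ g g∈P (h , k , h∈P , k∈P , g≗hwk) =
    w∉P (InP-cong (h ⁻¹ᴬ ∘ᴬ g ∘ᴬ k ⁻¹ᴬ) w w≗h⁻¹gk⁻¹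
      (InP-∘ (h ⁻¹ᴬ) (g ∘ᴬ k ⁻¹ᴬ) (InP-⁻¹ h h∈P) (InP-∘ g (k ⁻¹ᴬ) g∈P (InP-⁻¹ k k∈P))))
    where
      w≗h⁻¹gk⁻¹ : ∀ x → inv h (fun g (inv k x)) ≡ fun w x
      w≗h⁻¹gk⁻¹ x = trans (cong (inv h) (g≗hwk (inv k x))) (trans (inv-fun h _) (cong (fun w) (fun-inv k x)))

  inverse-w-factorisation : ∀ (g a b : Aut X) → (∀ x → fun g x ≡ fun a (fun w (fun b x))) →
                            ∀ x → inv g x ≡ inv b (fun w (inv a x))
  inverse-w-factorisation g a b g≗awb x = trans (cong (inv g) (sym gy≡x)) (inv-fun g y)
    where
      y = inv b (fun w (inv a x))
      gy≡x : fun g y ≡ x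
      gy≡x = trans (g≗awb y) (trans (cong (λ z → fun a (fun w z)) (fun-inv b _))
               (trans (cong (fun a) (w-invol _)) (fun-inv a x)))

  PwP-⁻¹ : ∀ g → InPwP g → InPwP (g ⁻¹ᴬ)
  PwP-⁻¹ g (h , k , h∈P , k∈P , g≗hwk) =
    k ⁻¹ᴬ , h ⁻¹ᴬ , InP-⁻¹ k k∈P , InP-⁻¹ h h∈P , inverse-w-factorisation g h k g≗hwk

  outside-P-factorisation : ∀ g → ¬ InP g →
    Σ Translation λ τ → ∃ λ k → InP k × (∀ x → fun g x ≡ translate τ (fun w (fun k x)))
  outside-P-factorisation g g∉P = τ , w ∘ᴬ n ⁻¹ᴬ ∘ᴬ g , k∈P , λ x →
    sym (trans (cong (translate τ) (w-invol (inv n (fun g x)))) (fun-inv n (fun g x)))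
    where
      cusp : Σ Translation λ τ → translation τ · bwd v ∥ g · ray∞
      cusp = translation-onto-cusp (·-IsRay g (proj₁ ray∞-RayTo∞)) g∉P
      τ = proj₁ cusp
      n = translation τ
      k∈P : InP (w ∘ᴬ n ⁻¹ᴬ ∘ᴬ g)
      k∈P = begin
        w · (n ⁻¹ᴬ · (g · ray∞))   ≈⟨ ·-∥ w (n ⁻¹ᴬ · (n · bwd v)) (n ⁻¹ᴬ · (g · ray∞))
                                        (·-∥ (n ⁻¹ᴬ) (n · bwd v) (g · ray∞) (proj₂ cusp)) ⟨
        w · (n ⁻¹ᴬ · (n · bwd v))  ≈⟨ ≗⇒∥ (λ i → cong (fun w) (inv-fun n (bwd v i))) ⟩
        w · bwd v                  ≈⟨ ≗⇒∥ (λ i → trans (w-line (- + i)) (cong v (ℤP.neg-involutive (+ i)))) ⟩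
        ray∞                       ∎

  NwP⇒PwP : ∀ g → InNwP g → InPwP g
  NwP⇒PwP g (n , k , n∈N , k∈P , g≗nwk) = n , k , InN⇒InP n n∈N , k∈P , g≗nwk

  PwN⇒PwP : ∀ g → InPwN g → InPwP g
  PwN⇒PwP g (h , n , h∈P , n∈N , g≗hwn) = h , n , h∈P , InN⇒InP n n∈N , g≗hwn

  outside-P⇒NwP : ∀ g → ¬ InP g → InNwP g
  outside-P⇒NwP g g∉P =
    let τ , k , k∈P , g≗τwk = outside-P-factorisation g g∉P in
    translation τ , k , translation-InN τ , k∈P , g≗τwk

  P∪PwP : ∀ g → InP g ⊎ InPwP g
  P∪PwP g with em (InP g)
  ... | yes g∈P = inj₁ g∈P
  ... | no  g∉P = inj₂ (NwP⇒PwP g (outside-P⇒NwP g g∉P))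

  PwP⇒NwP : ∀ g → InPwP g → InNwP g
  PwP⇒NwP g g∈PwP = outside-P⇒NwP g (λ g∈P → P∩PwP≡∅ g g∈P g∈PwP)

  PwP⇒PwN : ∀ g → InPwP g → InPwN g
  PwP⇒PwN g g∈PwP =
    let τ , k , k∈P , g⁻¹≗τwk = outside-P-factorisation (g ⁻¹ᴬ) (λ g⁻¹∈P → P∩PwP≡∅ (g ⁻¹ᴬ) g⁻¹∈P (PwP-⁻¹ g g∈PwP)) in
    k ⁻¹ᴬ , translation (negate τ) , InP-⁻¹ k k∈P , translation-InN (negate τ) ,
    inverse-w-factorisation (g ⁻¹ᴬ) (translation τ) k g⁻¹≗τwk

mainTheorem14 : (q : ℕ) (D : Setup q) → ExcludedMiddle →
    (∀ g → Setup.InP D g ⊎ Setup.InPwP D g)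
    × (∀ g → Setup.InP D g → Setup.InPwP D g → ⊥)
    × (∀ g → (Setup.InPwP D g → Setup.InNwP D g) × (Setup.InNwP D g → Setup.InPwP D g))
    × (∀ g → (Setup.InPwP D g → Setup.InPwN D g) × (Setup.InPwN D g → Setup.InPwP D g))
mainTheorem14 q D em =
  P∪PwP , P∩PwP≡∅ , (λ g → PwP⇒NwP g , NwP⇒PwP g) , (λ g → PwP⇒PwN g , PwN⇒PwP g)
  where open BruhatDecomposition D em
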